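{- For every integer $n\ge1$ and every positive integer $r$, writing $W_m(k)=\sum_{j\ge0}\omega(k-jm)$: (a) $\displaystyle\sum_{k=1}^{n}(2^{\tau(k)}-1)\,\omega(n-k)=\sum_{\substack{m+k=n\\ m\ge 1,\ k\ge 0}}\Phi^\tau(m)W_m(k)$; (b) $\displaystyle\sum_{k=1}^{n}\binom{\tau(k)}{r}\omega(n-k)=\sum_{\substack{m+k=n\\ m\ge 1,\ k\ge 0}}\Phi^\tau_r(m)W_m(k)$.
   Context: $\tau(k)$ is the number of positive divisors of $k$. For a positive integer $m$, $\Phi^\tau(m)$ (resp. $\Phi^\tau_r(m)$) is the number of nonempty subsets (resp. subsets of cardinality $r$) $S$ of the set of positive divisors of $m$ such that $\gcd(\gcd(S),m)=1$. For integers $m$, $\omega(m)=1$ if $m=0$; $\omega(m)=(-1)^i$ if $m=\frac{3i^2\pm i}{2}$ for some positive integer $i$; $\omega(m)=0$ otherwise (in particular for $m<0$). -}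

module Defs where

open import Data.Nat as ℕ using (ℕ; zero; suc; _≡ᵇ_)
open import Data.Nat.Divisibility using (_∣?_)
open import Data.Nat.GCD using (gcd)
open import Data.Integer as ℤ using (ℤ; +_; -[1+_]; _-_)
open import Data.List using (List; []; _∷_; filter; length; map; foldr; upTo; applyUpTo)
open import Data.Bool using (Bool; true; false; if_then_else_; _∨_)
open import Relation.Nullary.Decidable using (does)

divisors : ℕ → List ℕ
divisors m = filter (λ d → d ∣? m) (applyUpTo suc m)

τ : ℕ → ℕ
τ k = length (divisors k)

subsets : {A : Set} → List A → List (List A)
subsets []       = [] ∷ []
subsets (x ∷ xs) = subsets xs Data.List.++ map (x ∷_) (subsets xs)

-- gcd of a finite set (gcd of the empty set is 0)
gcdList : List ℕ → ℕ
gcdList = foldr gcd 0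

isNonempty : {A : Set} → List A → Bool
isNonempty []      = false
isNonempty (_ ∷ _) = true

goodSubset : ℕ → List ℕ → Bool
goodSubset m S = gcd (gcdList S) m ≡ᵇ 1

count : {A : Set} → (A → Bool) → List A → ℕ
count p []       = 0
count p (x ∷ xs) = (if p x then 1 else 0) ℕ.+ count p xs

Φτ : ℕ → ℕ
Φτ m = count (λ S → isNonempty S Data.Bool.∧ goodSubset m S) (subsets (divisors m))

Φτr : ℕ → ℕ → ℕ
Φτr r m = count (λ S → (length S ≡ᵇ r) Data.Bool.∧ goodSubset m S) (subsets (divisors m))

-- does m = (3i² + i)/2 or m = (3i² - i)/2 for the given i ?  (i.e. 2m = 3i² ± i)
isPent : ℕ → ℕ → Bool
isPent m i = ((2 ℕ.* m) ≡ᵇ (3 ℕ.* i ℕ.* i ℕ.+ i)) ∨ ((2 ℕ.* m) ≡ᵇ (3 ℕ.* i ℕ.* i ℕ.∸ i))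

signPow : ℕ → ℤ
signPow zero          = + 1
signPow (suc zero)    = -[1+ 0 ]
signPow (suc (suc i)) = signPow i

-- search i ∈ {1,…,b} with isPent m i; returns (-1)^i for the first found, else 0
-- (the generalized pentagonal numbers (3i²±i)/2, i ≥ 1, are pairwise distinct, so i is unique)
searchPent : ℕ → List ℕ → ℤ
searchPent m []       = + 0
searchPent m (i ∷ is) = if isPent m i then signPow i else searchPent m is

ωℕ : ℕ → ℤ
ωℕ zero      = + 1
ωℕ (suc m)   = searchPent (suc m) (applyUpTo suc (suc m))   -- any such i satisfies 1 ≤ i ≤ m

ω : ℤ → ℤ
ω (+ m)     = ωℕ m
ω -[1+ m ]  = + 0

-- Σ_{k=a}^{b} f k  (empty if b < a)
Σ[_⋯_] : ℕ → ℕ → (ℕ → ℤ) → ℤ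
Σ[ a ⋯ b ] f = foldr ℤ._+_ (+ 0) (map (λ i → f (a ℕ.+ i)) (upTo (suc b ℕ.∸ a)))

-- W_m(k) = Σ_{j ≥ 0} ω(k - j m). For m ≥ 1 all terms with j > k vanish
-- (the argument is negative), so the sum is the finite sum over 0 ≤ j ≤ k.
W : ℕ → ℕ → ℤ
W m k = Σ[ 0 ⋯ k ] (λ j → ω (+ k - + (j ℕ.* m)))

{-# OPTIONS --safe #-}
-- For a property P of finite sets of divisors that is preserved by relabelling elements
-- (nonempty, of size r), group the P-subsets S of the divisors of k by g = gcd(gcd S, k).
-- Dividing by g identifies the class of g with the P-subsets T of the divisors of k/g having
-- gcd(gcd T, k/g) = 1, so the number of P-subsets of the divisors of k (2^τ(k) − 1, resp.
-- C(τ(k), r)) is Σ_{g e = k} Φ(e). Multiplying by ω(n − k), summing over k and exchanging the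
-- order of summation leaves, for each e, the inner sum Σ_{g ≥ 1} ω(n − g e) = W_e(n − e).
module Submission where

open import Defs
open import Data.Bool using (Bool; true; false; if_then_else_; _∧_; T)
open import Data.Fin using (toℕ)
open import Data.Fin.Properties using (toℕ<n)
open import Data.Integer using (ℤ; +_; 0ℤ; -_; _+_; _*_; _-_)
import Data.Integer.Properties as ℤP
open import Algebra.Properties.Semiring.Sum ℤP.+-*-semiring using (sum; sum-cong-≗; sum-replicate-zero; ∑-distrib-+; ∑-comm; *-distribˡ-sum; *-distribʳ-sum)
open import Data.List using (List; []; _∷_; [_]; _++_; _∷ʳ_; filter; length; map; foldr; applyUpTo)
open import Data.List.Properties using (map-++; map-∘; filter-++; filter-none; filter-accept; filter-≐; applyUpTo-∷ʳ; length-map)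
open import Data.List.Relation.Unary.All as All using (All; []; _∷_)
open import Data.List.Relation.Unary.All.Properties using (applyUpTo⁺₁)
open import Data.Nat as ℕ using (ℕ; zero; suc; _≥_; _≤_; _<_; z≤n; s≤s; z<s; s<s; _^_; _∸_; _≡ᵇ_; NonZero)
import Data.Nat.Properties as ℕP
open import Data.Nat.Properties using (_≟_)
open import Data.Nat.Combinatorics using (_C_; nCk+nC[k+1]≡[n+1]C[k+1])
open import Data.Nat.Divisibility using (_∣_; _∣?_; divides; ∣-refl; ∣-trans; ∣⇒≤; ∣m+n∣m⇒∣n; ∣m∣n⇒∣m+n; m∣m*n; *-cancelˡ-∣; *-monoʳ-∣)
open import Data.Nat.GCD using (gcd; gcd[m,n]∣m; gcd[m,n]∣n; gcd[m,n]≢0; c*gcd[m,n]≡gcd[cm,cn])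
open import Data.Product using (_×_; _,_)
open import Data.Sum using (inj₂)
open import Function using (_∘_; id; mk⇔)
open import Relation.Binary.PropositionalEquality using (_≡_; _≢_; _≗_; refl; sym; trans; cong; cong₂; subst; module ≡-Reasoning)
open import Relation.Nullary using (¬_; yes; no; does; contradiction)
open import Relation.Nullary.Decidable using (dec-true; dec-false; does-⇔)
open import Relation.Unary using (Pred; Decidable)

private variable
  A B : Set

-- Sums over initial segments of ℕ

∑< : ℕ → (ℕ → ℤ) → ℤ
∑< n f = sum {n} (f ∘ toℕ)

infixr 5 ∑<
syntax ∑< n (λ i → x) = ∑[ i < n ] x

∑-cong : ∀ n {f g : ℕ → ℤ} → (∀ i → i < n → f i ≡ g i) → ∑< n f ≡ ∑< n g
∑-cong n f≡g = sum-cong-≗ (λ i → f≡g (toℕ i) (toℕ<n i))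

∑-zero : ∀ n {f : ℕ → ℤ} → (∀ i → i < n → f i ≡ 0ℤ) → ∑< n f ≡ 0ℤ
∑-zero n f≡0 = trans (∑-cong n f≡0) (sum-replicate-zero n)

∑-+ : ∀ n (f g : ℕ → ℤ) → ∑[ i < n ] (f i + g i) ≡ ∑< n f + ∑< n g
∑-+ n f g = ∑-distrib-+ {n} (f ∘ toℕ) (g ∘ toℕ)

∑-swap : ∀ m n (f : ℕ → ℕ → ℤ) → ∑[ i < m ] ∑[ j < n ] f i j ≡ ∑[ j < n ] ∑[ i < m ] f i j
∑-swap m n f = ∑-comm {m} {n} (λ i j → f (toℕ i) (toℕ j))

*-∑ : ∀ n x (f : ℕ → ℤ) → x * ∑< n f ≡ ∑[ i < n ] (x * f i)
*-∑ n x f = *-distribˡ-sum {n} x (f ∘ toℕ)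

∑-* : ∀ n x (f : ℕ → ℤ) → ∑< n f * x ≡ ∑[ i < n ] (f i * x)
∑-* n x f = *-distribʳ-sum {n} x (f ∘ toℕ)

∑-single : ∀ {n} j {f : ℕ → ℤ} → j < n → (∀ i → i < n → i ≢ j → f i ≡ 0ℤ) → ∑< n f ≡ f j
∑-single {suc n} zero {f} _ f≡0 = trans
  (cong (λ s → f 0 + s) (∑-zero n (λ i i<n → f≡0 (suc i) (s<s i<n) λ ())))
  (ℤP.+-identityʳ (f 0))
∑-single {suc n} (suc j) (s<s j<n) f≡0 = trans
  (cong₂ _+_ (f≡0 0 z<s λ ()) (∑-single j j<n (λ i i<n i≢j → f≡0 (suc i) (s<s i<n) (i≢j ∘ ℕP.suc-injective))))
  (ℤP.+-identityˡ _)

∑-extend : ∀ {m n} {f : ℕ → ℤ} → m ≤ n → (∀ i → m ≤ i → i < n → f i ≡ 0ℤ) → ∑< m f ≡ ∑< n f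
∑-extend {zero} {n} _ f≡0 = sym (∑-zero n (λ i → f≡0 i z≤n))
∑-extend {suc m} {suc n} {f} (s≤s m≤n) f≡0 =
  cong (λ s → f 0 + s) (∑-extend m≤n (λ i m≤i i<n → f≡0 (suc i) (s≤s m≤i) (s<s i<n)))

infix 7 _when_
_when_ : ℤ → Bool → ℤ
x when b = if b then x else 0ℤ

∑-when-≡ : ∀ n (c : ℤ) (h : ℕ → ℤ) → (∀ k → n < k → h k ≡ 0ℤ) → ∀ k → 0 < k →
  ∑[ a < n ] ((c when (k ≡ᵇ suc a)) * h (suc a)) ≡ c * h k
∑-when-≡ n c h h≡0 (suc k) _ with k ℕ.<? n
... | yes k<n = trans
  (∑-single k k<n (λ a _ a≢k → cong (λ b → (c when b) * h (suc a))
    (dec-false (suc k ≟ suc a) (a≢k ∘ sym ∘ ℕP.suc-injective))))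
  (cong (λ b → (c when b) * h (suc k)) (dec-true (suc k ≟ suc k) refl))
... | no k≮n = trans
  (∑-zero n (λ a a<n → cong (λ b → (c when b) * h (suc a))
    (dec-false (suc k ≟ suc a) (λ eq → k≮n (subst (_< n) (sym (ℕP.suc-injective eq)) a<n)))))
  (sym (trans (cong (c *_) (h≡0 (suc k) (s≤s (ℕP.≮⇒≥ k≮n)))) (ℤP.*-zeroʳ c)))

∑-convolution : ∀ n (Φ h : ℕ → ℤ) → (∀ k → n < k → h k ≡ 0ℤ) →
  ∑[ a < n ] ((∑[ i < n ] ∑[ j < n ] (Φ (suc j) when (suc i ℕ.* suc j ≡ᵇ suc a))) * h (suc a))
    ≡ ∑[ j < n ] (Φ (suc j) * (∑[ i < n ] h (suc i ℕ.* suc j)))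
∑-convolution n Φ h h≡0 = begin
  ∑[ a < n ] ((∑[ i < n ] ∑[ j < n ] δ i j a) * h (suc a))
    ≡⟨ ∑-cong n (λ a _ → trans (∑-* n (h (suc a)) (λ i → ∑[ j < n ] δ i j a))
                                (∑-cong n (λ i _ → ∑-* n (h (suc a)) (λ j → δ i j a)))) ⟩
  ∑[ a < n ] ∑[ i < n ] ∑[ j < n ] (δ i j a * h (suc a))
    ≡⟨ ∑-swap n n (λ a i → ∑[ j < n ] (δ i j a * h (suc a))) ⟩
  ∑[ i < n ] ∑[ a < n ] ∑[ j < n ] (δ i j a * h (suc a))
    ≡⟨ ∑-cong n (λ i _ → ∑-swap n n (λ a j → δ i j a * h (suc a))) ⟩
  ∑[ i < n ] ∑[ j < n ] ∑[ a < n ] (δ i j a * h (suc a))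
    ≡⟨ ∑-cong n (λ i _ → ∑-cong n (λ j _ → ∑-when-≡ n (Φ (suc j)) h h≡0 (suc i ℕ.* suc j) z<s)) ⟩
  ∑[ i < n ] ∑[ j < n ] (Φ (suc j) * h (suc i ℕ.* suc j))
    ≡⟨ ∑-swap n n (λ i j → Φ (suc j) * h (suc i ℕ.* suc j)) ⟩
  ∑[ j < n ] ∑[ i < n ] (Φ (suc j) * h (suc i ℕ.* suc j))
    ≡⟨ ∑-cong n (λ j _ → *-∑ n (Φ (suc j)) (λ i → h (suc i ℕ.* suc j))) ⟨
  ∑[ j < n ] (Φ (suc j) * (∑[ i < n ] h (suc i ℕ.* suc j))) ∎
  where
  open ≡-Reasoning
  δ : ℕ → ℕ → ℕ → ℤ
  δ i j a = Φ (suc j) when (suc i ℕ.* suc j ≡ᵇ suc a)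

foldr-+-map-applyUpTo : ∀ (g : ℕ → ℤ) h n → foldr _+_ 0ℤ (map g (applyUpTo h n)) ≡ ∑[ i < n ] g (h i)
foldr-+-map-applyUpTo g h zero    = refl
foldr-+-map-applyUpTo g h (suc n) = cong (λ s → g (h 0) + s) (foldr-+-map-applyUpTo g (h ∘ suc) n)

Σ⋯≡∑ : ∀ a b f → Σ[ a ⋯ b ] f ≡ ∑[ i < suc b ∸ a ] f (a ℕ.+ i)
Σ⋯≡∑ a b f = foldr-+-map-applyUpTo _ id (suc b ∸ a)

-- Counting subsets

count-++ : ∀ (p : A → Bool) xs ys → count p (xs ++ ys) ≡ count p xs ℕ.+ count p ys
count-++ p []       ys = refl
count-++ p (x ∷ xs) ys = trans (cong (_ ℕ.+_) (count-++ p xs ys)) (sym (ℕP.+-assoc (if p x then 1 else 0) _ _))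

count-map : ∀ (p : B → Bool) (f : A → B) xs → count p (map f xs) ≡ count (p ∘ f) xs
count-map p f []       = refl
count-map p f (x ∷ xs) = cong (_ ℕ.+_) (count-map p f xs)

count-cong : ∀ {p q : A → Bool} → p ≗ q → count p ≗ count q
count-cong p≗q []       = refl
count-cong p≗q (x ∷ xs) = cong₂ (λ b n → (if b then 1 else 0) ℕ.+ n) (p≗q x) (count-cong p≗q xs)

count-none : ∀ {p : A → Bool} → (∀ x → ¬ T (p x)) → ∀ xs → count p xs ≡ 0
count-none             ¬p []       = refl
count-none {p = p} ¬p (x ∷ xs) with p x | ¬p x
... | false | _  = count-none ¬p xs
... | true  | ¬t = contradiction _ ¬t

count-subsets-∷ : ∀ (p : List A → Bool) x xs →
  count p (subsets (x ∷ xs)) ≡ count p (subsets xs) ℕ.+ count (p ∘ (x ∷_)) (subsets xs)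
count-subsets-∷ p x xs = trans (count-++ p (subsets xs) _) (cong (_ ℕ.+_) (count-map p (x ∷_) (subsets xs)))

count-subsets : ∀ (xs : List A) → count (λ _ → true) (subsets xs) ≡ 2 ^ length xs
count-subsets []       = refl
count-subsets (x ∷ xs) = trans (count-subsets-∷ _ x xs)
  (cong₂ ℕ._+_ (count-subsets xs) (trans (count-subsets xs) (sym (ℕP.+-identityʳ _))))

count-nonempty-subsets : ∀ (xs : List A) → suc (count isNonempty (subsets xs)) ≡ 2 ^ length xs
count-nonempty-subsets []       = refl
count-nonempty-subsets (x ∷ xs) = begin
  suc (count isNonempty (subsets (x ∷ xs)))
    ≡⟨ cong suc (count-subsets-∷ isNonempty x xs) ⟩
  suc (count isNonempty (subsets xs)) ℕ.+ count (λ _ → true) (subsets xs)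
    ≡⟨ cong₂ ℕ._+_ (count-nonempty-subsets xs) (count-subsets xs) ⟩
  2 ^ length xs ℕ.+ 2 ^ length xs
    ≡⟨ cong (2 ^ length xs ℕ.+_) (sym (ℕP.+-identityʳ _)) ⟩
  2 ^ length (x ∷ xs) ∎
  where open ≡-Reasoning

count-subsets-of-length : ∀ (xs : List A) r → count (λ S → length S ≡ᵇ r) (subsets xs) ≡ length xs C r
count-subsets-of-length []       zero    = refl
count-subsets-of-length []       (suc r) = refl
count-subsets-of-length (x ∷ xs) zero    = trans (count-subsets-∷ _ x xs)
  (cong₂ ℕ._+_ (count-subsets-of-length xs zero) (count-none (λ _ ()) (subsets xs)))
count-subsets-of-length (x ∷ xs) (suc r) = begin
  count (λ S → length S ≡ᵇ suc r) (subsets (x ∷ xs))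
    ≡⟨ count-subsets-∷ _ x xs ⟩
  count (λ S → length S ≡ᵇ suc r) (subsets xs) ℕ.+ count (λ S → length S ≡ᵇ r) (subsets xs)
    ≡⟨ cong₂ ℕ._+_ (count-subsets-of-length xs (suc r)) (count-subsets-of-length xs r) ⟩
  length xs C suc r ℕ.+ length xs C r
    ≡⟨ ℕP.+-comm (length xs C suc r) _ ⟩
  length xs C r ℕ.+ length xs C suc r
    ≡⟨ nCk+nC[k+1]≡[n+1]C[k+1] (length xs) r ⟩
  length (x ∷ xs) C suc r ∎
  where open ≡-Reasoning

count-subsets-filter : ∀ {ℓ} {P : Pred A ℓ} (P? : Decidable P) {q : List A → Bool} →
  (∀ S → T (q S) → All P S) → ∀ xs → count q (subsets xs) ≡ count q (subsets (filter P? xs))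
count-subsets-filter P?     q⇒P []       = refl
count-subsets-filter P? {q} q⇒P (x ∷ xs) with P? x
... | yes _ = begin
  count q (subsets (x ∷ xs))
    ≡⟨ count-subsets-∷ q x xs ⟩
  count q (subsets xs) ℕ.+ count (q ∘ (x ∷_)) (subsets xs)
    ≡⟨ cong₂ ℕ._+_ (count-subsets-filter P? q⇒P xs) (count-subsets-filter P? (λ S → All.tail ∘ q⇒P (x ∷ S)) xs) ⟩
  count q (subsets ys) ℕ.+ count (q ∘ (x ∷_)) (subsets ys)
    ≡⟨ count-subsets-∷ q x ys ⟨
  count q (subsets (x ∷ ys)) ∎
  where open ≡-Reasoning; ys = filter P? xs
... | no ¬Px = begin
  count q (subsets (x ∷ xs))
    ≡⟨ count-subsets-∷ q x xs ⟩
  count q (subsets xs) ℕ.+ count (q ∘ (x ∷_)) (subsets xs)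
    ≡⟨ cong₂ ℕ._+_ (count-subsets-filter P? q⇒P xs) (count-none (λ S → ¬Px ∘ All.head ∘ q⇒P (x ∷ S)) (subsets xs)) ⟩
  count q (subsets (filter P? xs)) ℕ.+ 0
    ≡⟨ ℕP.+-identityʳ _ ⟩
  count q (subsets (filter P? xs)) ∎
  where open ≡-Reasoning

subsets-map : ∀ (f : A → B) xs → subsets (map f xs) ≡ map (map f) (subsets xs)
subsets-map f []       = refl
subsets-map f (x ∷ xs) = begin
  subsets (map f xs) ++ map (f x ∷_) (subsets (map f xs))
    ≡⟨ cong (λ Ss → Ss ++ map (f x ∷_) Ss) (subsets-map f xs) ⟩
  map (map f) Ss ++ map (f x ∷_) (map (map f) Ss)
    ≡⟨ cong (map (map f) Ss ++_) (trans (sym (map-∘ Ss)) (map-∘ Ss)) ⟩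
  map (map f) Ss ++ map (map f) (map (x ∷_) Ss)
    ≡⟨ map-++ (map f) Ss _ ⟨
  map (map f) (Ss ++ map (x ∷_) Ss) ∎
  where
  open ≡-Reasoning
  Ss = subsets xs

indicator-split : ∀ b {v} N → 0 < v → v ≤ N →
  + (if b then 1 else 0) ≡ ∑[ i < N ] + (if b ∧ (v ≡ᵇ suc i) then 1 else 0)
indicator-split false       N _ _   = sym (∑-zero N (λ _ _ → refl))
indicator-split true {suc j} N _ j<N = sym (trans
  (∑-single j j<N (λ i _ i≢j → cong (λ b → + (if b then 1 else 0)) (dec-false (suc j ≟ suc i) (i≢j ∘ sym ∘ ℕP.suc-injective))))
  (cong (λ b → + (if b then 1 else 0)) (dec-true (suc j ≟ suc j) refl)))

count-partition : ∀ (p : A → Bool) (v : A → ℕ) N → (∀ x → 0 < v x) → (∀ x → v x ≤ N) → ∀ xs →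
  + count p xs ≡ ∑[ i < N ] + count (λ x → p x ∧ (v x ≡ᵇ suc i)) xs
count-partition p v N v>0 v≤N []       = sym (∑-zero N (λ _ _ → refl))
count-partition {A} p v N v>0 v≤N (x ∷ xs) = begin
  + count p (x ∷ xs)
    ≡⟨ ℤP.pos-+ ⟦ p x ⟧ (count p xs) ⟩
  + ⟦ p x ⟧ + + count p xs
    ≡⟨ cong₂ _+_ (indicator-split (p x) N (v>0 x) (v≤N x)) (count-partition p v N v>0 v≤N xs) ⟩
  (∑[ i < N ] + ⟦ pᵢ i x ⟧) + (∑[ i < N ] + count (pᵢ i) xs)
    ≡⟨ ∑-+ N (λ i → + ⟦ pᵢ i x ⟧) (λ i → + count (pᵢ i) xs) ⟨
  ∑[ i < N ] (+ ⟦ pᵢ i x ⟧ + + count (pᵢ i) xs)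
    ≡⟨ ∑-cong N (λ i _ → sym (ℤP.pos-+ ⟦ pᵢ i x ⟧ (count (pᵢ i) xs))) ⟩
  ∑[ i < N ] + count (pᵢ i) (x ∷ xs) ∎
  where
  open ≡-Reasoning
  ⟦_⟧ : Bool → ℕ
  ⟦ b ⟧ = if b then 1 else 0
  pᵢ : ℕ → A → Bool
  pᵢ i x = p x ∧ (v x ≡ᵇ suc i)

-- The multiples of d among the divisors of d e

filter-comm : ∀ {ℓ₁ ℓ₂} {P : Pred A ℓ₁} {Q : Pred A ℓ₂} (P? : Decidable P) (Q? : Decidable Q) →
  filter P? ∘ filter Q? ≗ filter Q? ∘ filter P?
filter-comm P? Q? []       = refl
filter-comm P? Q? (x ∷ xs) with does (Q? x) in Qx | does (P? x) in Px
... | true  | true  rewrite Qx | Px = cong (x ∷_) (filter-comm P? Q? xs)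
... | true  | false rewrite Px      = filter-comm P? Q? xs
... | false | true  rewrite Qx      = filter-comm P? Q? xs
... | false | false = filter-comm P? Q? xs

filter-map : ∀ {ℓ} {P : Pred B ℓ} (P? : Decidable P) (f : A → B) →
  filter P? ∘ map f ≗ map f ∘ filter (P? ∘ f)
filter-map P? f []       = refl
filter-map P? f (x ∷ xs) with P? (f x)
... | yes _ = cong (f x ∷_) (filter-map P? f xs)
... | no  _ = filter-map P? f xs

applyUpTo-+ : ∀ (f : ℕ → A) m n → applyUpTo f (m ℕ.+ n) ≡ applyUpTo f m ++ applyUpTo (λ i → f (m ℕ.+ i)) n
applyUpTo-+ f zero    n = refl
applyUpTo-+ f (suc m) n = cong (f 0 ∷_) (applyUpTo-+ (f ∘ suc) m n)

filter-∣-block : ∀ d {m} → .{{NonZero d}} → d ∣ m →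
  filter (d ∣?_) (applyUpTo (λ i → suc (m ℕ.+ i)) d) ≡ [ m ℕ.+ d ]
filter-∣-block d@(suc d′) {m} d∣m = begin
  filter (d ∣?_) (applyUpTo f d)
    ≡⟨ cong (filter (d ∣?_)) (applyUpTo-∷ʳ f d′) ⟨
  filter (d ∣?_) (applyUpTo f d′ ∷ʳ f d′)
    ≡⟨ filter-++ (d ∣?_) (applyUpTo f d′) [ f d′ ] ⟩
  filter (d ∣?_) (applyUpTo f d′) ++ filter (d ∣?_) [ f d′ ]
    ≡⟨ cong₂ _++_ (filter-none (d ∣?_) (applyUpTo⁺₁ f d′ (d∤m+1+i ∘ s<s))) (filter-accept (d ∣?_) d∣m+d) ⟩
  [ f d′ ]
    ≡⟨ cong [_] (ℕP.+-suc m d′) ⟨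
  [ m ℕ.+ d ] ∎
  where
  open ≡-Reasoning
  f : ℕ → ℕ
  f i = suc (m ℕ.+ i)
  d∤m+1+i : ∀ {i} → suc i < d → ¬ d ∣ f i
  d∤m+1+i {i} 1+i<d d∣f = ℕP.<⇒≱ 1+i<d (∣⇒≤ (∣m+n∣m⇒∣n (subst (d ∣_) (sym (ℕP.+-suc m i)) d∣f) d∣m))
  d∣m+d : d ∣ f d′
  d∣m+d = subst (d ∣_) (ℕP.+-suc m d′) (∣m∣n⇒∣m+n d∣m ∣-refl)

filter-∣-applyUpTo : ∀ d e → .{{NonZero d}} →
  filter (d ∣?_) (applyUpTo suc (d ℕ.* e)) ≡ map (d ℕ.*_) (applyUpTo suc e)
filter-∣-applyUpTo d zero    = cong (filter (d ∣?_) ∘ applyUpTo suc) (ℕP.*-zeroʳ d)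
filter-∣-applyUpTo d (suc e) = begin
  filter (d ∣?_) (applyUpTo suc (d ℕ.* suc e))
    ≡⟨ cong (filter (d ∣?_) ∘ applyUpTo suc) d[1+e]≡de+d ⟩
  filter (d ∣?_) (applyUpTo suc (de ℕ.+ d))
    ≡⟨ cong (filter (d ∣?_)) (applyUpTo-+ suc de d) ⟩
  filter (d ∣?_) (applyUpTo suc de ++ applyUpTo (λ i → suc (de ℕ.+ i)) d)
    ≡⟨ filter-++ (d ∣?_) (applyUpTo suc de) _ ⟩
  filter (d ∣?_) (applyUpTo suc de) ++ filter (d ∣?_) (applyUpTo (λ i → suc (de ℕ.+ i)) d)
    ≡⟨ cong₂ _++_ (filter-∣-applyUpTo d e) (filter-∣-block d (m∣m*n e)) ⟩
  map (d ℕ.*_) (applyUpTo suc e) ++ [ de ℕ.+ d ]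
    ≡⟨ cong (λ k → map (d ℕ.*_) (applyUpTo suc e) ++ [ k ]) d[1+e]≡de+d ⟨
  map (d ℕ.*_) (applyUpTo suc e) ++ [ d ℕ.* suc e ]
    ≡⟨ map-++ (d ℕ.*_) (applyUpTo suc e) [ suc e ] ⟨
  map (d ℕ.*_) (applyUpTo suc e ∷ʳ suc e)
    ≡⟨ cong (map (d ℕ.*_)) (applyUpTo-∷ʳ suc e) ⟩
  map (d ℕ.*_) (applyUpTo suc (suc e)) ∎
  where
  open ≡-Reasoning
  de = d ℕ.* e
  d[1+e]≡de+d : d ℕ.* suc e ≡ de ℕ.+ d
  d[1+e]≡de+d = trans (ℕP.*-suc d e) (ℕP.+-comm d de)

filter-∣-divisors : ∀ d e → .{{NonZero d}} → filter (d ∣?_) (divisors (d ℕ.* e)) ≡ map (d ℕ.*_) (divisors e)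
filter-∣-divisors d e = begin
  filter (d ∣?_) (filter (_∣? d ℕ.* e) (applyUpTo suc (d ℕ.* e)))
    ≡⟨ filter-comm (d ∣?_) (_∣? d ℕ.* e) (applyUpTo suc (d ℕ.* e)) ⟩
  filter (_∣? d ℕ.* e) (filter (d ∣?_) (applyUpTo suc (d ℕ.* e)))
    ≡⟨ cong (filter (_∣? d ℕ.* e)) (filter-∣-applyUpTo d e) ⟩
  filter (_∣? d ℕ.* e) (map (d ℕ.*_) (applyUpTo suc e))
    ≡⟨ filter-map (_∣? d ℕ.* e) (d ℕ.*_) (applyUpTo suc e) ⟩
  map (d ℕ.*_) (filter (λ x → d ℕ.* x ∣? d ℕ.* e) (applyUpTo suc e))
    ≡⟨ cong (map (d ℕ.*_)) (filter-≐ (λ x → d ℕ.* x ∣? d ℕ.* e) (_∣? e) (*-cancelˡ-∣ d , *-monoʳ-∣ d) (applyUpTo suc e)) ⟩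
  map (d ℕ.*_) (divisors e) ∎
  where open ≡-Reasoning

-- Grouping subsets of divisors by gcd

MapInvariant : (List ℕ → Bool) → Set
MapInvariant P = ∀ (f : ℕ → ℕ) S → P (map f S) ≡ P S

gcdCount : (List ℕ → Bool) → ℕ → ℕ → ℕ
gcdCount P k g = count (λ S → P S ∧ (gcd (gcdList S) k ≡ᵇ g)) (subsets (divisors k))

-- Φτ and Φτr r are, definitionally, Φ[ isNonempty ] and Φ[ (λ S → length S ≡ᵇ r) ].
Φ[_] : (List ℕ → Bool) → ℕ → ℕ
Φ[ P ] m = gcdCount P m 1

T[b∧m≡ᵇn]⇒m≡n : ∀ b {m n} → T (b ∧ (m ≡ᵇ n)) → m ≡ n
T[b∧m≡ᵇn]⇒m≡n true = ℕP.≡ᵇ⇒≡ _ _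

gcdList-map-* : ∀ d S → gcdList (map (d ℕ.*_) S) ≡ d ℕ.* gcdList S
gcdList-map-* d []      = sym (ℕP.*-zeroʳ d)
gcdList-map-* d (x ∷ S) =
  trans (cong (gcd (d ℕ.* x)) (gcdList-map-* d S)) (sym (c*gcd[m,n]≡gcd[cm,cn] d x (gcdList S)))

∣gcdList⇒All∣ : ∀ {d} S → d ∣ gcdList S → All (d ∣_) S
∣gcdList⇒All∣ []      _   = []
∣gcdList⇒All∣ (x ∷ S) d∣g =
  ∣-trans d∣g (gcd[m,n]∣m x (gcdList S)) ∷ ∣gcdList⇒All∣ S (∣-trans d∣g (gcd[m,n]∣n x (gcdList S)))

[d*x≡ᵇd]≡[x≡ᵇ1] : ∀ d x → .{{NonZero d}} → (d ℕ.* x ≡ᵇ d) ≡ (x ≡ᵇ 1)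
[d*x≡ᵇd]≡[x≡ᵇ1] d x = does-⇔
  (mk⇔ (λ dx≡d → ℕP.*-cancelˡ-≡ x 1 d (trans dx≡d (sym (ℕP.*-identityʳ d))))
       (λ x≡1 → trans (cong (d ℕ.*_) x≡1) (ℕP.*-identityʳ d)))
  (d ℕ.* x ≟ d) (x ≟ 1)

gcdCount-* : ∀ {P} → MapInvariant P → ∀ d e → .{{NonZero d}} → gcdCount P (d ℕ.* e) d ≡ Φ[ P ] e
gcdCount-* {P} P-inv d e = begin
  count q (subsets (divisors (d ℕ.* e)))
    ≡⟨ count-subsets-filter (d ∣?_) q⇒All∣ (divisors (d ℕ.* e)) ⟩
  count q (subsets (filter (d ∣?_) (divisors (d ℕ.* e))))
    ≡⟨ cong (count q ∘ subsets) (filter-∣-divisors d e) ⟩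
  count q (subsets (map (d ℕ.*_) (divisors e)))
    ≡⟨ cong (count q) (subsets-map (d ℕ.*_) (divisors e)) ⟩
  count q (map (map (d ℕ.*_)) (subsets (divisors e)))
    ≡⟨ count-map q (map (d ℕ.*_)) (subsets (divisors e)) ⟩
  count (q ∘ map (d ℕ.*_)) (subsets (divisors e))
    ≡⟨ count-cong q∘map≗ (subsets (divisors e)) ⟩
  Φ[ P ] e ∎
  where
  open ≡-Reasoning
  q : List ℕ → Bool
  q S = P S ∧ (gcd (gcdList S) (d ℕ.* e) ≡ᵇ d)
  q⇒All∣ : ∀ S → T (q S) → All (d ∣_) S
  q⇒All∣ S qS = ∣gcdList⇒All∣ S
    (subst (_∣ gcdList S) (T[b∧m≡ᵇn]⇒m≡n (P S) qS) (gcd[m,n]∣m (gcdList S) (d ℕ.* e)))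
  q∘map≗ : ∀ S → q (map (d ℕ.*_) S) ≡ P S ∧ goodSubset e S
  q∘map≗ S = cong₂ _∧_ (P-inv (d ℕ.*_) S) (begin
    gcd (gcdList (map (d ℕ.*_) S)) (d ℕ.* e) ≡ᵇ d
      ≡⟨ cong (λ g → gcd g (d ℕ.* e) ≡ᵇ d) (gcdList-map-* d S) ⟩
    gcd (d ℕ.* gcdList S) (d ℕ.* e) ≡ᵇ d
      ≡⟨ cong (_≡ᵇ d) (c*gcd[m,n]≡gcd[cm,cn] d (gcdList S) e) ⟨
    d ℕ.* gcd (gcdList S) e ≡ᵇ d
      ≡⟨ [d*x≡ᵇd]≡[x≡ᵇ1] d (gcd (gcdList S) e) ⟩
    goodSubset e S ∎)

gcdCount≡∑ : ∀ {P} → MapInvariant P → ∀ {N k} i → 0 < k → k ≤ N →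
  + gcdCount P k (suc i) ≡ ∑[ j < N ] (+ Φ[ P ] (suc j) when (suc i ℕ.* suc j ≡ᵇ k))
gcdCount≡∑ {P} P-inv {N} {k} i 0<k k≤N with suc i ∣? k
... | yes (divides zero k≡0) = contradiction k≡0 (ℕP.n>0⇒n≢0 0<k)
... | yes (divides (suc e) k≡[1+e][1+i]) = begin
  + gcdCount P k (suc i)
    ≡⟨ cong (λ k → + gcdCount P k (suc i)) k≡[1+i][1+e] ⟩
  + gcdCount P (suc i ℕ.* suc e) (suc i)
    ≡⟨ cong +_ (gcdCount-* P-inv (suc i) (suc e)) ⟩
  + Φ[ P ] (suc e)
    ≡⟨ cong (+ Φ[ P ] (suc e) when_) (dec-true (suc i ℕ.* suc e ≟ k) (sym k≡[1+i][1+e])) ⟨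
  + Φ[ P ] (suc e) when (suc i ℕ.* suc e ≡ᵇ k)
    ≡⟨ ∑-single e e<N (λ j _ j≢e → cong (+ Φ[ P ] (suc j) when_) (dec-false (suc i ℕ.* suc j ≟ k)
         (j≢e ∘ ℕP.suc-injective ∘ ℕP.*-cancelˡ-≡ (suc j) (suc e) (suc i) ∘ (λ eq → trans eq k≡[1+i][1+e])))) ⟨
  ∑[ j < N ] (+ Φ[ P ] (suc j) when (suc i ℕ.* suc j ≡ᵇ k)) ∎
  where
  open ≡-Reasoning
  k≡[1+i][1+e] : k ≡ suc i ℕ.* suc e
  k≡[1+i][1+e] = trans k≡[1+e][1+i] (ℕP.*-comm (suc e) (suc i))
  e<N : e < N
  e<N = ℕP.≤-trans (ℕP.m≤n*m (suc e) (suc i)) (subst (_≤ N) k≡[1+i][1+e] k≤N)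
... | no 1+i∤k = trans
  (cong +_ (count-none (λ S → 1+i∤k ∘ gcd≡1+i⇒1+i∣k S) (subsets (divisors k))))
  (sym (∑-zero N (λ j _ → cong (+ Φ[ P ] (suc j) when_)
    (dec-false (suc i ℕ.* suc j ≟ k) (λ eq → 1+i∤k (subst (suc i ∣_) eq (m∣m*n (suc j))))))))
  where
  gcd≡1+i⇒1+i∣k : ∀ S → T (P S ∧ (gcd (gcdList S) k ≡ᵇ suc i)) → suc i ∣ k
  gcd≡1+i⇒1+i∣k S t = subst (_∣ k) (T[b∧m≡ᵇn]⇒m≡n (P S) t) (gcd[m,n]∣n (gcdList S) k)

count-subsets-divisors≡∑Φ : ∀ {P} → MapInvariant P → ∀ {N k} → 0 < k → k ≤ N →
  + count P (subsets (divisors k)) ≡ ∑[ i < N ] ∑[ j < N ] (+ Φ[ P ] (suc j) when (suc i ℕ.* suc j ≡ᵇ k))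
count-subsets-divisors≡∑Φ {P} P-inv {N} {k} 0<k k≤N = trans
  (count-partition P (λ S → gcd (gcdList S) k) N gcd>0 gcd≤N (subsets (divisors k)))
  (∑-cong N (λ i _ → gcdCount≡∑ P-inv i 0<k k≤N))
  where
  gcd>0 : ∀ S → 0 < gcd (gcdList S) k
  gcd>0 S = ℕP.n≢0⇒n>0 (gcd[m,n]≢0 (gcdList S) k (inj₂ (ℕP.n>0⇒n≢0 0<k)))
  gcd≤N : ∀ S → gcd (gcdList S) k ≤ N
  gcd≤N S = ℕP.≤-trans (∣⇒≤ {{ℕ.>-nonZero 0<k}} (gcd[m,n]∣n (gcdList S) k)) k≤N

-- Summing against ω

+[m∸n]≡+m-+n : ∀ {m n} → n ≤ m → + (m ∸ n) ≡ + m - + n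
+[m∸n]≡+m-+n {m} {n} n≤m = sym (trans (ℤP.m-n≡m⊖n m n) (ℤP.⊖-≥ n≤m))

ω-neg : ∀ {m k} → m < k → ω (+ m - + k) ≡ 0ℤ
ω-neg {m} {k} m<k = trans (cong ω (trans (ℤP.m-n≡m⊖n m k) (ℤP.⊖-< m<k))) (ω-[-x] (ℕP.m<n⇒0<n∸m m<k))
  where
  ω-[-x] : ∀ {x} → 0 < x → ω (- + x) ≡ 0ℤ
  ω-[-x] {suc _} _ = refl

n∸m<i⇒n<[1+i]*m : ∀ {n m i} → 0 < m → m ≤ n → n ∸ m < i → n < suc i ℕ.* m
n∸m<i⇒n<[1+i]*m {n} {m} {i} 0<m m≤n n∸m<i = begin-strict
  n              ≡⟨ ℕP.m+[n∸m]≡n m≤n ⟨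
  m ℕ.+ (n ∸ m)  <⟨ ℕP.+-monoʳ-< m n∸m<i ⟩
  m ℕ.+ i        ≤⟨ ℕP.+-monoʳ-≤ m (ℕP.m≤m*n i m {{ℕ.>-nonZero 0<m}}) ⟩
  suc i ℕ.* m    ∎
  where open ℕP.≤-Reasoning

W-as-∑ : ∀ {n m} → 0 < m → m ≤ n → W m (n ∸ m) ≡ ∑[ i < n ] ω (+ n - + (suc i ℕ.* m))
W-as-∑ {n} {m} 0<m m≤n = begin
  W m (n ∸ m)
    ≡⟨ Σ⋯≡∑ 0 (n ∸ m) (λ j → ω (+ (n ∸ m) - + (j ℕ.* m))) ⟩
  ∑[ j < suc (n ∸ m) ] ω (+ (n ∸ m) - + (j ℕ.* m))
    ≡⟨ ∑-cong (suc (n ∸ m)) (λ j _ → cong ω (shift j)) ⟩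
  ∑[ j < suc (n ∸ m) ] ω (+ n - + (suc j ℕ.* m))
    ≡⟨ ∑-extend (ℕP.∸-monoʳ-< 0<m m≤n) (λ i n∸m<i _ → ω-neg (n∸m<i⇒n<[1+i]*m 0<m m≤n n∸m<i)) ⟩
  ∑[ i < n ] ω (+ n - + (suc i ℕ.* m)) ∎
  where
  open ≡-Reasoning
  shift : ∀ j → + (n ∸ m) - + (j ℕ.* m) ≡ + n - + (suc j ℕ.* m)
  shift j = begin
    + (n ∸ m) - + (j ℕ.* m)      ≡⟨ cong (_- + (j ℕ.* m)) (+[m∸n]≡+m-+n m≤n) ⟩
    + n - + m - + (j ℕ.* m)      ≡⟨ ℤP.+-assoc (+ n) (- + m) (- + (j ℕ.* m)) ⟩
    + n + (- + m - + (j ℕ.* m))  ≡⟨ cong (λ x → + n + x) (ℤP.neg-distrib-+ (+ m) (+ (j ℕ.* m))) ⟨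
    + n - (+ m + + (j ℕ.* m))    ≡⟨ cong (λ x → + n - x) (ℤP.pos-+ m (j ℕ.* m)) ⟨
    + n - + (suc j ℕ.* m)        ∎

ω-convolution : ∀ (P : List ℕ → Bool) {F : ℕ → ℤ} → MapInvariant P →
  (∀ k → F k ≡ + count P (subsets (divisors k))) → ∀ n →
  Σ[ 1 ⋯ n ] (λ k → F k * ω (+ (n ∸ k))) ≡ Σ[ 1 ⋯ n ] (λ m → + Φ[ P ] m * W m (n ∸ m))
ω-convolution P {F} P-inv F≡ n = begin
  Σ[ 1 ⋯ n ] (λ k → F k * ω (+ (n ∸ k)))
    ≡⟨ Σ⋯≡∑ 1 n (λ k → F k * ω (+ (n ∸ k))) ⟩
  ∑[ a < n ] (F (suc a) * ω (+ (n ∸ suc a)))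
    ≡⟨ ∑-cong n (λ a a<n → cong₂ _*_ (trans (F≡ (suc a)) (count-subsets-divisors≡∑Φ P-inv z<s a<n))
                                      (cong ω (+[m∸n]≡+m-+n a<n))) ⟩
  ∑[ a < n ] ((∑[ i < n ] ∑[ j < n ] (+ Φ[ P ] (suc j) when (suc i ℕ.* suc j ≡ᵇ suc a))) * h (suc a))
    ≡⟨ ∑-convolution n (λ m → + Φ[ P ] m) h (λ _ → ω-neg) ⟩
  ∑[ j < n ] (+ Φ[ P ] (suc j) * (∑[ i < n ] h (suc i ℕ.* suc j)))
    ≡⟨ ∑-cong n (λ j j<n → cong (λ w → + Φ[ P ] (suc j) * w) (W-as-∑ z<s j<n)) ⟨
  ∑[ j < n ] (+ Φ[ P ] (suc j) * W (suc j) (n ∸ suc j))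
    ≡⟨ Σ⋯≡∑ 1 n (λ m → + Φ[ P ] m * W m (n ∸ m)) ⟨
  Σ[ 1 ⋯ n ] (λ m → + Φ[ P ] m * W m (n ∸ m)) ∎
  where
  open ≡-Reasoning
  h : ℕ → ℤ
  h k = ω (+ n - + k)

isNonempty-map : MapInvariant isNonempty
isNonempty-map f []      = refl
isNonempty-map f (_ ∷ _) = refl

-- Both identities hold for every n and r.
mainTheorem18 : (n r : ℕ) → n ≥ 1 → r ≥ 1 →
    (Σ[ 1 ⋯ n ] (λ k → (+ (2 ^ τ k) - + 1) * ω (+ (n ∸ k)))
      ≡ Σ[ 1 ⋯ n ] (λ m → + Φτ m * W m (n ∸ m)))
    × (Σ[ 1 ⋯ n ] (λ k → + (τ k C r) * ω (+ (n ∸ k)))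
      ≡ Σ[ 1 ⋯ n ] (λ m → + Φτr r m * W m (n ∸ m)))
mainTheorem18 n r _ _ =
    ω-convolution isNonempty isNonempty-map
      (λ k → cong (λ c → + c - + 1) (sym (count-nonempty-subsets (divisors k)))) n
  , ω-convolution (λ S → length S ≡ᵇ r) (λ f S → cong (_≡ᵇ r) (length-map f S))
      (λ k → cong +_ (sym (count-subsets-of-length (divisors k) r))) n
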